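{- Let $H$ be a hypergraph and $p\in(0,1)$. If every edge in $H$ is flammable with respect to $p$, then $b_{L,p}(H)\leq b_L(H)$ and $b_p(H)\leq b(H)$.
   Context: A hypergraph $H=(V(H),E(H))$ has a finite nonempty vertex set and a finite collection $E(H)$ of subsets of $V(H)$ called edges (parallel edges allowed). An edge $e$ is non-flammable with respect to $p$ if $\lceil p|e|\rceil=|e|$, and flammable otherwise. Given a propagation rule, the burning game is: let $F_0=\emptyset$ and $F_r$ be the set of burned vertices at the end of round $r$; in each round $r\geq 1$, simultaneously, vertices catch fire by propagation from $F_{r-1}$ (no propagation in round 1), and a player chooses a vertex $u_r\notin F_{r-1}$ (a source) and sets it on fire; burned vertices stay burned. A burning sequence is a sequence $(u_1,\ldots,u_k)$ of such sources after which every vertex is on fire at the end of round $k$. In the lazy game, $S\subseteq V(H)$ is a lazy burning set if, setting all of $S$ on fire at once and then repeatedly applying the propagation rule, every vertex eventually catches fire. Proportion-based rule (proportion $p$): if at least $\lceil p|e|\rceil$ vertices of an edge $e$ are on fire, then at the next step all vertices of $e$ catch fire; $b_p(H)$ and $b_{L,p}(H)$ denote the minimum length of a burning sequence and minimum size of a lazy burning set under this rule. Original rule: a vertex $v$ catches fire at the next step if there is an edge $\{v,u_1,\ldots,u_k\}$ with all of $u_1,\ldots,u_k$ on fire; $b(H)$ and $b_L(H)$ denote the minimum length of a burning sequence and minimum size of a lazy burning set under this rule.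
   Formalization: The proportion $p$ ranges over the rationals in $(0,1)$. -}

module Defs where

open import Data.Nat using (ℕ; zero; suc; _≤_)
open import Data.Integer as ℤ using (ℤ; +_)
open import Data.Rational using (ℚ; ceiling; _*_; _/_)
open import Data.Fin using (Fin)
open import Data.Fin.Subset using (Subset; ⊥; ⊤; ⁅_⁆; _∪_; _∩_; ⋃; ∣_∣; _-_; _∉_)
open import Data.Fin.Subset.Properties using (_⊆?_; _∈?_)
open import Data.List using (List; []; _∷_; length; filter)
open import Data.Bool.ListAction using (any)
open import Data.Vec using (tabulate)
open import Data.Bool using (_∧_)
open import Data.Product using (_×_; Σ; ∃)
open import Relation.Nullary using (¬_; does)
open import Relation.Binary.PropositionalEquality using (_≡_)

-- A hypergraph: vertex set Fin n with n ≥ 1 (finite, nonempty), and a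
-- finite collection (list, so parallel edges are allowed) of subsets.
record Hypergraph : Set where
  field
    n        : ℕ
    nonempty : 1 ≤ n
    edges    : List (Subset n)
open Hypergraph public

card : ∀ {n} → Subset n → ℚ
card e = (+ ∣ e ∣) / 1

NonFlammable : ∀ {n} → ℚ → Subset n → Set
NonFlammable p e = ceiling (p * card e) ≡ + ∣ e ∣

Flammable : ∀ {n} → ℚ → Subset n → Set
Flammable p e = ¬ NonFlammable p e

-- A propagation rule: given the set F of burned vertices, the set of
-- vertices that catch fire at the next step by propagation.
Rule : ℕ → Set
Rule n = Subset n → Subset n

propRule : (H : Hypergraph) → ℚ → Rule (n H)
propRule H p F =
  ⋃ (filter (λ e → ceiling (p * card e) ℤ.≤? (+ ∣ e ∩ F ∣)) (edges H))

origRule : (H : Hypergraph) → Rule (n H)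
origRule H F =
  tabulate (λ v → any (λ e → does (v ∈? e) ∧ does ((e - v) ⊆? F)) (edges H))

-- Remaining rounds r ≥ 2: F is the set burned at the end of the previous
-- round; the source must be unburned there; the new set is
-- F ∪ (propagation from F) ∪ {u}.
BurnsFrom : ∀ {n} → Rule n → Subset n → List (Fin n) → Set
BurnsFrom R F []       = F ≡ ⊤
BurnsFrom R F (u ∷ us) = (u ∉ F) × BurnsFrom R (F ∪ R F ∪ ⁅ u ⁆) us

-- Round 1: no propagation, F₁ = {u₁} (u₁ ∉ F₀ = ∅ holds trivially).
BurningSequence : ∀ {n} → Rule n → List (Fin n) → Set
BurningSequence {n} R []       = ⊥ {n} ≡ ⊤
BurningSequence R (u ∷ us) = BurnsFrom R ⁅ u ⁆ us

IsBurningNumber : ∀ {n} → Rule n → ℕ → Set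
IsBurningNumber R b =
  (Σ _ λ us → BurningSequence R us × length us ≡ b) ×
  (∀ us → BurningSequence R us → b ≤ length us)

iterate : ∀ {n} → Rule n → ℕ → Subset n → Subset n
iterate R zero    S = S
iterate R (suc t) S = iterate R t (S ∪ R S)

LazyBurningSet : ∀ {n} → Rule n → Subset n → Set
LazyBurningSet R S = ∃ λ t → iterate R t S ≡ ⊤

IsLazyBurningNumber : ∀ {n} → Rule n → ℕ → Set
IsLazyBurningNumber R b =
  (Σ _ λ S → LazyBurningSet R S × ∣ S ∣ ≡ b) ×
  (∀ S → LazyBurningSet R S → b ≤ ∣ S ∣)

-- If the original rule burns v along e, every vertex of e except v is on fire.  A flammable
-- edge has ⌈p|e|⌉ < |e|, so at least ⌈p|e|⌉ of its vertices burn and the proportion rule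
-- fires along e too.  As the proportion rule is moreover monotone, starting from at least
-- as much fire it keeps burning at least as much as the original rule, round by round.
-- Hence every lazy burning set for the original rule is one for the proportion rule, and
-- every burning sequence for the original rule can be turned into one for the proportion
-- rule that is no longer.
module Submission where

open import Data.Bool using (Bool; T; _∧_)
open import Data.Bool.ListAction using (any)
open import Data.Bool.Properties using (T-≡)
open import Data.Fin using (Fin; zero; suc)
open import Data.Fin.Subset using (Subset; inside; outside; _∈_; _∉_; _⊆_; _∪_; _∩_; _-_; ⋃; ⁅_⁆; ∁; ⊤; ∣_∣)
open import Data.Fin.Subset.Properties
open import Data.Integer as ℤ using (ℤ; +_)
import Data.Integer.Properties as ℤ
open import Data.Integer.DivMod using (n<s[n/ℕd]*d; div-pos-is-/ℕ)
open import Data.Integer.GCD using (gcd-zeroʳ)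
open import Data.List using ([]; _∷_; length; filter)
open import Data.List.Relation.Unary.All using (All; _∷_)
open import Data.List.Relation.Unary.Any as Any using (Any; here; there)
open import Data.List.Relation.Unary.Any.Properties using (any⁻)
open import Data.Nat as ℕ using (ℕ; zero; suc; _≤_; z≤n; s≤s)
import Data.Nat.Properties as ℕ
open import Data.Product as Prod using (_×_; _,_; ∃)
open import Data.Rational as ℚ using (ℚ; mkℚ; ↥_; ↧_; _/_; floor; ceiling; 0ℚ; 1ℚ; _<_)
import Data.Rational.Properties as ℚ
open import Data.Sum as Sum using (_⊎_; inj₁; inj₂; [_,_]′)
open import Data.Vec using (_∷_; lookup)
open import Data.Vec.Properties using ([]=⇒lookup; lookup∘tabulate)
open import Function using (_∘_)
open import Function.Bundles using (Equivalence)
open import Relation.Nullary using (yes; no; does; contradiction)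
open import Relation.Unary using (Pred; Decidable)
open import Relation.Binary.PropositionalEquality

open import Defs

Any-zipAll : ∀ {a p q r} {A : Set a} {P : Pred A p} {Q : Pred A q} {R : Pred A r} →
             (∀ {x} → P x → Q x → R x) → ∀ {xs} → All P xs → Any Q xs → Any R xs
Any-zipAll f (px ∷ _)   (here qx)  = here (f px qx)
Any-zipAll f (_  ∷ pxs) (there qs) = there (Any-zipAll f pxs qs)

∪-mono : ∀ {n} {p p′ q q′ : Subset n} → p ⊆ p′ → q ⊆ q′ → p ∪ q ⊆ p′ ∪ q′
∪-mono {p = p} {q = q} p⊆p′ q⊆q′ x∈ =
  x∈p∪q⁺ (Sum.map p⊆p′ q⊆q′ (x∈p∪q⁻ p q x∈))

≡⊤-⊆ : ∀ {n} {p q : Subset n} → p ≡ ⊤ → p ⊆ q → q ≡ ⊤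
≡⊤-⊆ refl ⊤⊆q = ⊆-antisym ⊆⊤ ⊤⊆q

∣p∣≤1+∣p-x∣ : ∀ {n} (p : Subset n) (x : Fin n) → ∣ p ∣ ≤ suc ∣ p - x ∣
∣p∣≤1+∣p-x∣ (s ∷ p) zero = subst (λ q → ∣ s ∷ p ∣ ≤ suc ∣ q ∣) (sym (p─⊥≡p p)) (∣x∷p∣≤1+∣p∣ s)
  where
  ∣x∷p∣≤1+∣p∣ : ∀ s → ∣ s ∷ p ∣ ≤ suc ∣ p ∣
  ∣x∷p∣≤1+∣p∣ inside  = ℕ.≤-refl
  ∣x∷p∣≤1+∣p∣ outside = ℕ.n≤1+n ∣ p ∣
∣p∣≤1+∣p-x∣ (outside ∷ p) (suc x) = ∣p∣≤1+∣p-x∣ p x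
∣p∣≤1+∣p-x∣ (inside  ∷ p) (suc x) = s≤s (∣p∣≤1+∣p-x∣ p x)

replacementSource : ∀ {n} (G : Subset n) (u : Fin n) → G ≡ ⊤ ⊎ ∃ λ w → w ∉ G × ⁅ u ⁆ ⊆ G ∪ ⁅ w ⁆
replacementSource G u with u ∈? G | nonempty? (∁ G)
... | no u∉G  | _                = inj₂ (u , u∉G , q⊆p∪q G ⁅ u ⁆)
... | yes u∈G | yes (w , w∈∁G)   = inj₂ (w , x∈∁p⇒x∉p w∈∁G , p⊆p∪q ⁅ w ⁆ ∘ ⁅u⁆⊆G)
  where
  ⁅u⁆⊆G : ⁅ u ⁆ ⊆ G
  ⁅u⁆⊆G v∈⁅u⁆ = subst (_∈ G) (sym (x∈⁅y⁆⇒x≡y u v∈⁅u⁆)) u∈G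
... | yes _   | no ∁G-empty      = inj₁ (⊆-antisym ⊆⊤ λ _ → x∉∁p⇒x∈p (λ w∈∁G → ∁G-empty (_ , w∈∁G)))

module _ {n ℓ} {P : Pred (Subset n) ℓ} (P? : Decidable P) where

  ∈⋃-filter⁺ : ∀ {x} es → Any (λ e → P e × x ∈ e) es → x ∈ ⋃ (filter P? es)
  ∈⋃-filter⁺ (e ∷ es) (here (Pe , x∈e)) with P? e
  ... | yes _  = x∈p∪q⁺ (inj₁ x∈e)
  ... | no ¬Pe = contradiction Pe ¬Pe
  ∈⋃-filter⁺ (e ∷ es) (there x∈es) with P? e
  ... | yes _ = x∈p∪q⁺ (inj₂ (∈⋃-filter⁺ es x∈es))
  ... | no _  = ∈⋃-filter⁺ es x∈es

  ∈⋃-filter⁻ : ∀ {x} es → x ∈ ⋃ (filter P? es) → Any (λ e → P e × x ∈ e) es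
  ∈⋃-filter⁻ []       x∈⊥ = contradiction x∈⊥ ∉⊥
  ∈⋃-filter⁻ (e ∷ es) x∈ with P? e
  ... | yes Pe = [ (λ x∈e → here (Pe , x∈e)) , there ∘ ∈⋃-filter⁻ es ]′ (x∈p∪q⁻ e _ x∈)
  ... | no _   = there (∈⋃-filter⁻ es x∈)

floor-greatest : ∀ (q : ℚ) (m : ℤ) → m ℤ.* ↧ q ℤ.≤ ↥ q → m ℤ.≤ floor q
floor-greatest (mkℚ a d-1 _) m m↧q≤↥q = ℤ.≮⇒≥ λ ⌊q⌋<m → ℤ.<-irrefl refl (begin-strict
  a                           <⟨ n<s[n/ℕd]*d a d ⟩
  ℤ.suc (a ℤ./ℕ d) ℤ.* + d    ≡⟨ cong (λ i → ℤ.suc i ℤ.* + d) (sym (div-pos-is-/ℕ a d)) ⟩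
  ℤ.suc (a ℤ./ + d) ℤ.* + d   ≤⟨ ℤ.*-monoʳ-≤-nonNeg (+ d) (ℤ.i<j⇒suc[i]≤j ⌊q⌋<m) ⟩
  m ℤ.* + d                   ≤⟨ m↧q≤↥q ⟩
  a                           ∎)
  where
  open ℤ.≤-Reasoning
  d = suc d-1

ceiling-least : ∀ (q : ℚ) (m : ℤ) → ↥ q ℤ.≤ m ℤ.* ↧ q → ceiling q ℤ.≤ m
ceiling-least q@(mkℚ _ _ _) m ↥q≤m↧q =
  subst (ceiling q ℤ.≤_) (ℤ.neg-involutive m) (ℤ.neg-mono-≤ (floor-greatest (ℚ.- q) (ℤ.- m) -m↧-q≤↥-q))
  where
  open ℤ.≤-Reasoning
  -m↧-q≤↥-q : ℤ.- m ℤ.* ↧ (ℚ.- q) ℤ.≤ ↥ (ℚ.- q)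
  -m↧-q≤↥-q = begin
    ℤ.- m ℤ.* ↧ (ℚ.- q)  ≡⟨ cong (ℤ.- m ℤ.*_) (ℚ.↧-neg q) ⟩
    ℤ.- m ℤ.* ↧ q        ≡⟨ sym (ℤ.neg-distribˡ-* m (↧ q)) ⟩
    ℤ.- (m ℤ.* ↧ q)      ≤⟨ ℤ.neg-mono-≤ ↥q≤m↧q ⟩
    ℤ.- ↥ q              ≡⟨ sym (ℚ.↥-neg q) ⟩
    ↥ (ℚ.- q)            ∎

↥[i/1]≡i : ∀ i → ↥ (i / 1) ≡ i
↥[i/1]≡i i = trans (sym (ℤ.*-identityʳ _)) (trans (cong (↥ (i / 1) ℤ.*_) (sym (gcd-zeroʳ i))) (ℚ.↥-/ i 1))

↧[i/1]≡1 : ∀ i → ↧ (i / 1) ≡ + 1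
↧[i/1]≡1 i = trans (sym (ℤ.*-identityʳ _)) (trans (cong (↧ (i / 1) ℤ.*_) (sym (gcd-zeroʳ i))) (ℚ.↧-/ i 1))

ceiling-least-/1 : ∀ (q : ℚ) (m : ℤ) → q ℚ.≤ m / 1 → ceiling q ℤ.≤ m
ceiling-least-/1 q m q≤m = ceiling-least q m (begin
  ↥ q                      ≡⟨ sym (ℤ.*-identityʳ (↥ q)) ⟩
  ↥ q ℤ.* + 1              ≡⟨ cong (↥ q ℤ.*_) (sym (↧[i/1]≡1 m)) ⟩
  ↥ q ℤ.* ↧ (m / 1)        ≤⟨ ℚ.drop-*≤* q≤m ⟩
  ↥ (m / 1) ℤ.* ↧ q        ≡⟨ cong (ℤ._* ↧ q) (↥[i/1]≡i m) ⟩
  m ℤ.* ↧ q                ∎)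
  where open ℤ.≤-Reasoning

ceiling[p*k]≤k : ∀ (p : ℚ) (k : ℕ) → p ℚ.≤ 1ℚ → ceiling (p ℚ.* (+ k / 1)) ℤ.≤ + k
ceiling[p*k]≤k p k p≤1 = ceiling-least-/1 _ (+ k) (begin
  p ℚ.* (+ k / 1)    ≤⟨ ℚ.*-monoʳ-≤-nonNeg (+ k / 1) p≤1 ⟩
  1ℚ ℚ.* (+ k / 1)   ≡⟨ ℚ.*-identityˡ (+ k / 1) ⟩
  + k / 1            ∎)
  where
  open ℚ.≤-Reasoning
  instance _ = ℚ.normalize-nonNeg k 1

Ignites : ∀ {n} → ℚ → Subset n → Subset n → Set
Ignites p F e = ceiling (p ℚ.* card e) ℤ.≤ + ∣ e ∩ F ∣

Ignites-mono : ∀ {n} (p : ℚ) {F G e : Subset n} → F ⊆ G → Ignites p F e → Ignites p G e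
Ignites-mono p {F} {G} {e} F⊆G ignites = ℤ.≤-trans ignites (ℤ.+≤+ (p⊆q⇒∣p∣≤∣q∣ e∩F⊆e∩G))
  where
  e∩F⊆e∩G : e ∩ F ⊆ e ∩ G
  e∩F⊆e∩G x∈ = x∈p∩q⁺ (Prod.map₂ F⊆G (x∈p∩q⁻ e F x∈))

Flammable⇒Ignites : ∀ {n} {p : ℚ} {e F : Subset n} (x : Fin n) → p ℚ.≤ 1ℚ →
                    Flammable p e → e - x ⊆ F → Ignites p F e
Flammable⇒Ignites {p = p} {e} {F} x p≤1 flammable e-x⊆F = ℤ.i<j⇒i≤pred[j] (begin-strict
  ceiling (p ℚ.* card e)  <⟨ ℤ.≤∧≢⇒< (ceiling[p*k]≤k p ∣ e ∣ p≤1) flammable ⟩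
  + ∣ e ∣                 ≤⟨ ℤ.+≤+ (ℕ.≤-trans (∣p∣≤1+∣p-x∣ e x) (s≤s (p⊆q⇒∣p∣≤∣q∣ e-x⊆e∩F))) ⟩
  + suc ∣ e ∩ F ∣         ∎)
  where
  open ℤ.≤-Reasoning
  e-x⊆e∩F : e - x ⊆ e ∩ F
  e-x⊆e∩F y∈ = x∈p∩q⁺ (p─q⊆p e ⁅ x ⁆ y∈ , e-x⊆F y∈)

module _ (H : Hypergraph) (p : ℚ) where

  ∈propRule⁺ : ∀ {F x} → Any (λ e → Ignites p F e × x ∈ e) (edges H) → x ∈ propRule H p F
  ∈propRule⁺ {F} = ∈⋃-filter⁺ (λ e → ceiling (p ℚ.* card e) ℤ.≤? + ∣ e ∩ F ∣) (edges H)

  ∈propRule⁻ : ∀ {F x} → x ∈ propRule H p F → Any (λ e → Ignites p F e × x ∈ e) (edges H)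
  ∈propRule⁻ {F} = ∈⋃-filter⁻ (λ e → ceiling (p ℚ.* card e) ℤ.≤? + ∣ e ∩ F ∣) (edges H)

  propRule-mono : ∀ {F G} → F ⊆ G → propRule H p F ⊆ propRule H p G
  propRule-mono F⊆G = ∈propRule⁺ ∘ Any.map (λ {e} → Prod.map₁ (Ignites-mono p {e = e} F⊆G)) ∘ ∈propRule⁻

∈origRule⁻ : ∀ H {F x} → x ∈ origRule H F → Any (λ e → x ∈ e × e - x ⊆ F) (edges H)
∈origRule⁻ H {F} {x} x∈ = Any.map witnesses (any⁻ (burnsVia x) (edges H) (Equivalence.from T-≡
  (trans (sym (lookup∘tabulate (λ v → any (burnsVia v) (edges H)) x)) ([]=⇒lookup x∈))))
  where
  burnsVia : Fin (n H) → Subset (n H) → Bool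
  burnsVia v e = does (v ∈? e) ∧ does (e - v ⊆? F)
  witnesses : ∀ {e} → T (burnsVia x e) → x ∈ e × e - x ⊆ F
  witnesses {e} t with x ∈? e | e - x ⊆? F | t
  ... | yes x∈e | yes e-x⊆F | _  = x∈e , e-x⊆F
  ... | yes _   | no _      | ()
  ... | no _    | _         | ()

origRule⊆propRule : ∀ H {p} → p ℚ.≤ 1ℚ → All (Flammable p) (edges H) →
                    ∀ F → origRule H F ⊆ propRule H p F
origRule⊆propRule H {p} p≤1 flammable F =
  ∈propRule⁺ H p ∘ Any-zipAll ignites flammable ∘ ∈origRule⁻ H
  where
  ignites : ∀ {x e} → Flammable p e → x ∈ e × e - x ⊆ F → Ignites p F e × x ∈ e
  ignites {x} flam (x∈e , e-x⊆F) = Flammable⇒Ignites x p≤1 flam e-x⊆F , x∈e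

_≼_ : ∀ {n} → Rule n → Rule n → Set
R₁ ≼ R₂ = ∀ {F G} → F ⊆ G → R₁ F ⊆ R₂ G

origRule≼propRule : ∀ H {p} → p ℚ.≤ 1ℚ → All (Flammable p) (edges H) → origRule H ≼ propRule H p
origRule≼propRule H {p} p≤1 flammable F⊆G = propRule-mono H p F⊆G ∘ origRule⊆propRule H p≤1 flammable _

module _ {n} {R₁ R₂ : Rule n} (R₁≼R₂ : R₁ ≼ R₂) where

  iterate-⊆ : ∀ t {S T} → S ⊆ T → iterate R₁ t S ⊆ iterate R₂ t T
  iterate-⊆ zero    S⊆T = S⊆T
  iterate-⊆ (suc t) S⊆T = iterate-⊆ t (∪-mono S⊆T (R₁≼R₂ S⊆T))

  lazyBurningSet-≼ : ∀ {S} → LazyBurningSet R₁ S → LazyBurningSet R₂ S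
  lazyBurningSet-≼ (t , burnt) = t , ≡⊤-⊆ burnt (iterate-⊆ t ⊆-refl)

  round-⊆ : ∀ {F G u w} → F ⊆ G → ⁅ u ⁆ ⊆ G ∪ ⁅ w ⁆ → F ∪ R₁ F ∪ ⁅ u ⁆ ⊆ G ∪ R₂ G ∪ ⁅ w ⁆
  round-⊆ {F} {G} F⊆G ⁅u⁆⊆ y∈ with x∈p∪q⁻ F _ y∈
  ... | inj₁ y∈F = x∈p∪q⁺ (inj₁ (F⊆G y∈F))
  ... | inj₂ y∈ with x∈p∪q⁻ (R₁ F) _ y∈
  ...   | inj₁ y∈R₁F = x∈p∪q⁺ (inj₂ (x∈p∪q⁺ (inj₁ (R₁≼R₂ F⊆G y∈R₁F))))
  ...   | inj₂ y∈⁅u⁆ = ∪-mono ⊆-refl (q⊆p∪q (R₂ G) _) (⁅u⁆⊆ y∈⁅u⁆)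

  -- A source u that already burns in the R₂-game is replaced by an unburned vertex, unless
  -- the R₂-game is already over.
  burnsFrom-≼ : ∀ us {F G} → F ⊆ G → BurnsFrom R₁ F us →
                ∃ λ vs → BurnsFrom R₂ G vs × length vs ≤ length us
  burnsFrom-≼ []       F⊆G F≡⊤ = [] , ≡⊤-⊆ F≡⊤ F⊆G , z≤n
  burnsFrom-≼ (u ∷ us) {G = G} F⊆G (_ , burns) with replacementSource G u
  ... | inj₁ G≡⊤               = [] , G≡⊤ , z≤n
  ... | inj₂ (w , w∉G , ⁅u⁆⊆) with burnsFrom-≼ us (round-⊆ F⊆G ⁅u⁆⊆) burns
  ...   | vs , burns′ , shorter = w ∷ vs , (w∉G , burns′) , s≤s shorter

  burningSequence-≼ : ∀ us → BurningSequence R₁ us →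
                      ∃ λ vs → BurningSequence R₂ vs × length vs ≤ length us
  burningSequence-≼ []       ⊥≡⊤   = [] , ⊥≡⊤ , z≤n
  burningSequence-≼ (u ∷ us) burns with burnsFrom-≼ us ⊆-refl burns
  ... | vs , burns′ , shorter = u ∷ vs , burns′ , s≤s shorter

  lazyBurningNumber-≼ : ∀ {b₁ b₂} → IsLazyBurningNumber R₂ b₂ → IsLazyBurningNumber R₁ b₁ → b₂ ≤ b₁
  lazyBurningNumber-≼ (_ , minimal) ((S , lazy , refl) , _) = minimal S (lazyBurningSet-≼ lazy)

  burningNumber-≼ : ∀ {b₁ b₂} → IsBurningNumber R₂ b₂ → IsBurningNumber R₁ b₁ → b₂ ≤ b₁
  burningNumber-≼ (_ , minimal) ((us , burns , refl) , _) with burningSequence-≼ us burns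
  ... | vs , burns′ , shorter = ℕ.≤-trans (minimal vs burns′) shorter

theorem2p26 : (H : Hypergraph) (p : ℚ) → 0ℚ < p → p < 1ℚ →
    All (Flammable p) (edges H) →
    (∀ bLp bL → IsLazyBurningNumber (propRule H p) bLp →
       IsLazyBurningNumber (origRule H) bL → bLp ≤ bL)
    ×
    (∀ bp b → IsBurningNumber (propRule H p) bp →
       IsBurningNumber (origRule H) b → bp ≤ b)
theorem2p26 H p _ p<1 flammable =
  (λ _ _ → lazyBurningNumber-≼ orig≼prop) , (λ _ _ → burningNumber-≼ orig≼prop)
  where
  orig≼prop : origRule H ≼ propRule H p
  orig≼prop = origRule≼propRule H (ℚ.<⇒≤ p<1) flammable
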